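{- Let $n\geq2$ and let $x=x_1x_2\cdots x_n$ be an ascent sequence, and $x'=x_1\cdots x_{n-1}$. Then $\mathrm{asctop}(x)=\max(\eta(x))$ and $\eta(x)=\mathrm{Add}(\eta(x'),x_n)$.
   Context: For a word $x=x_1\cdots x_n$ of positive integers, $\mathrm{Asctop}(x)=\{1\}\cup\{i:2\leq i\leq n,\ x_{i-1}<x_i\}$, $\mathrm{Ascbot}(x)=\{1\}\cup\{i:1\leq i\leq n-1,\ x_i<x_{i+1}\}$, and $\mathrm{asctop}(x)=|\mathrm{Asctop}(x)|$. An ascent sequence is a word $x$ with $x_1=1$ and $1\leq x_i\leq\mathrm{asctop}(x_1\cdots x_{i-1})+1$ for $2\leq i\leq n$. The map $\eta$: given an ascent sequence $x$ with $\mathrm{Ascbot}(x)=\{a_1<\cdots<a_k\}$, for $i=a_1,\dots,a_k$ in order, and for each $j=1,\dots,i-1$, if the current $x_j\geq x_i$ then replace $x_j$ by $x_j+1$; call the result $\tilde{x}$, and let $\eta(x)$ be $\tilde{x}$ with $\max(\tilde{x})$ prepended. For a word $x$ of length $n$ and $1\leq\ell\leq\max(x)+1$, $y=\mathrm{Add}(x,\ell)$ is the word of length $n+1$: if $\ell\leq x_n$, $y=x_1\cdots x_n\ell$; if $x_n<\ell$, then $y_n=x_n$, $y_{n+1}=\ell$, and for $1\leq i\leq n-1$, $y_i=x_i$ if $x_i<x_n$ and $y_i=x_i+1$ if $x_i\geq x_n$. -}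

module Defs where

open import Data.Nat using (ℕ; zero; suc; _+_; _≤_; _<_; _<ᵇ_; _≤ᵇ_; _⊔_)
open import Data.Bool using (Bool; true; false; if_then_else_)
open import Data.List using (List; []; _∷_; length; map; foldr; filter; upTo; reverse)
open import Data.Maybe using (Maybe; just; nothing)
open import Data.Product using (_×_; _,_)
open import Data.List.Relation.Unary.All using (All)

-- Words of positive integers are represented as lists of naturals.
-- Positions are 1-indexed as in the paper.

-- 1-indexed lookup (returns 0 out of range; only used in range)
at : List ℕ → ℕ → ℕ
at []       _             = 0
at (x ∷ xs) zero          = 0
at (x ∷ xs) (suc zero)    = x
at (x ∷ xs) (suc (suc i)) = at xs (suc i)

ascents : List ℕ → ℕ
ascents []           = 0
ascents (a ∷ [])     = 0
ascents (a ∷ b ∷ xs) = (if a <ᵇ b then 1 else 0) + ascents (b ∷ xs)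

-- asctop(x) = |{1} ∪ {i : 2 ≤ i ≤ n, x_{i-1} < x_i}|  (for nonempty x)
asctop : List ℕ → ℕ
asctop []       = 0
asctop (a ∷ xs) = suc (ascents (a ∷ xs))

-- Ascbot(x) = {1} ∪ {i : 1 ≤ i ≤ n-1, x_i < x_{i+1}}, as an increasing list
-- (for nonempty x)
ascbotFrom : ℕ → List ℕ → List ℕ
ascbotFrom i []           = []
ascbotFrom i (a ∷ [])     = []
ascbotFrom i (a ∷ b ∷ xs) =
  (if a <ᵇ b then (i ∷ []) else []) Data.List.++ ascbotFrom (suc i) (b ∷ xs)

Ascbot : List ℕ → List ℕ
Ascbot []           = []
Ascbot (a ∷ [])     = 1 ∷ []
Ascbot (a ∷ b ∷ xs) = 1 ∷ ascbotFrom 2 (b ∷ xs)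

-- Ascent sequences: x_1 = 1, and 1 ≤ x_i ≤ asctop(x_1 ⋯ x_{i-1}) + 1.
-- Defined via the reversed word (snoc-lists): IsAscentSeq holds of a list.
data IsAscentSeq : List ℕ → Set where
  one  : IsAscentSeq (1 ∷ [])
  snoc : ∀ {xs} (k : ℕ) → IsAscentSeq xs →
         1 ≤ k → k ≤ asctop xs + 1 →
         IsAscentSeq (xs Data.List.++ (k ∷ []))

max : List ℕ → ℕ
max = foldr _⊔_ 0

-- one step of η at position i: for j = 1..i-1, if x_j ≥ x_i replace x_j by x_j+1
-- (the value x_i is not changed during this step)
bumpBefore : ℕ → ℕ → List ℕ → List ℕ
bumpBefore v zero          xs       = xs
bumpBefore v (suc k)       []       = []
bumpBefore v (suc k)       (a ∷ xs) =
  (if v ≤ᵇ a then suc a else a) ∷ bumpBefore v k xs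

step : List ℕ → ℕ → List ℕ
step xs i = bumpBefore (at xs i) (i Data.Nat.∸ 1) xs

tilde : List ℕ → List ℕ
tilde x = foldl' (Ascbot x) x
  where
  foldl' : List ℕ → List ℕ → List ℕ
  foldl' []       acc = acc
  foldl' (i ∷ is) acc = foldl' is (step acc i)

η : List ℕ → List ℕ
η x = max (tilde x) ∷ tilde x

addInit : ℕ → List ℕ → List ℕ
addInit xn []       = []
addInit xn (a ∷ as) = (if a <ᵇ xn then a else suc a) ∷ addInit xn as

Add : List ℕ → ℕ → List ℕ
Add x ℓ with reverse x
... | []         = ℓ ∷ []
... | (xn ∷ ini) =
  if ℓ ≤ᵇ xn then x Data.List.++ (ℓ ∷ [])
  else addInit xn (reverse ini) Data.List.++ (xn ∷ ℓ ∷ [])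

-- Write x = x′ k with x′ = p u.  A step at position i only changes letters before i, and
-- every position of Ascbot(x′) other than 1 (where a step changes nothing) lies before u, so
-- the steps of η on x′ leave u and everything after it alone.  Hence x̃ = x̃′ k when u ≥ k,
-- while for u < k the position of u joins Ascbot and contributes one more step, which bumps
-- every earlier letter ≥ u: exactly what Add does to the initial segment.  In parallel asctop
-- grows by one iff u < k, and so does max x̃, which by induction equals asctop: letters of an
-- ascent sequence are bounded by asctop of their prefix, so u ≤ max x̃′ and k ≤ max x̃′ + 1.
module Submission where

open import Defs
open import Data.Nat using (ℕ; _≤_)
open import Data.List using (List; _∷_; []; _++_; length)
open import Data.Product using (_×_)
open import Relation.Binary.PropositionalEquality using (_≡_)

open import Data.Bool using (true; false; if_then_else_)
open import Data.Bool.Properties using (T-≡; ¬-not)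
open import Data.List using (foldl; [_]; _∷ʳ_)
open import Data.List.Properties
  using (foldl-++; ++-assoc; ++-identityʳ; reverse-++; reverse-involutive; ∷ʳ-injective)
open import Data.List.Relation.Unary.All using (All; []; _∷_)
open import Data.List.Relation.Unary.All.Properties using (++⁺)
open import Data.Nat using (zero; suc; _+_; _∸_; _<_; _⊔_; _<ᵇ_; _≤ᵇ_; z≤n; s≤s; z<s)
open import Data.Nat.Properties
  using (<⇒<ᵇ; <ᵇ⇒<; ≤⇒≤ᵇ; ≤ᵇ⇒≤; <⇒≱; <-≤-connex; ≤-refl; ≤-trans; <⇒≤; m≤n⇒m≤1+n; n≤1+n; m<m+n;
         +-suc; +-comm; +-assoc; +-identityʳ; ⊔-assoc; ⊔-identityʳ; ⊔-idem; m≤n⊔m;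
         m≤n⇒m⊔n≡n; m≥n⇒m⊔n≡m)
open import Data.Product using (_,_)
open import Data.Sum using (inj₁; inj₂)
open import Function.Bundles using (Equivalence)
open import Relation.Binary.PropositionalEquality
  using (refl; sym; trans; cong; cong₂; subst; module ≡-Reasoning)

<ᵇ-true : ∀ {m n} → m < n → (m <ᵇ n) ≡ true
<ᵇ-true m<n = Equivalence.to T-≡ (<⇒<ᵇ m<n)

<ᵇ-false : ∀ {m n} → n ≤ m → (m <ᵇ n) ≡ false
<ᵇ-false {m} {n} n≤m = ¬-not λ eq → <⇒≱ (<ᵇ⇒< m n (Equivalence.from T-≡ eq)) n≤m

≤ᵇ-true : ∀ {m n} → m ≤ n → (m ≤ᵇ n) ≡ true
≤ᵇ-true m≤n = Equivalence.to T-≡ (≤⇒≤ᵇ m≤n)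

≤ᵇ-false : ∀ {m n} → n < m → (m ≤ᵇ n) ≡ false
≤ᵇ-false {m} {n} n<m = ¬-not λ eq → <⇒≱ n<m (≤ᵇ⇒≤ m n (Equivalence.from T-≡ eq))

max-++ : ∀ xs ys → max (xs ++ ys) ≡ max xs ⊔ max ys
max-++ []       ys = refl
max-++ (x ∷ xs) ys = trans (cong (x ⊔_) (max-++ xs ys)) (sym (⊔-assoc x (max xs) (max ys)))

max-∷ʳ : ∀ xs k → max (xs ∷ʳ k) ≡ max xs ⊔ k
max-∷ʳ xs k = trans (max-++ xs [ k ]) (cong (max xs ⊔_) (⊔-identityʳ k))

⊔-ascent : ∀ {a u k m} → a ⊔ suc u ≡ suc m → u < k → k ≤ m + 1 → a ⊔ (u ⊔ k) ≡ m + 1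
⊔-ascent {a} {u} {k} {m} a⊔su≡sm u<k k≤ = begin
  a ⊔ (u ⊔ k)       ≡⟨ cong (a ⊔_) (m≤n⇒m⊔n≡n (<⇒≤ u<k)) ⟩
  a ⊔ k             ≡⟨ cong (a ⊔_) (sym (m≤n⇒m⊔n≡n u<k)) ⟩
  a ⊔ (suc u ⊔ k)   ≡⟨ sym (⊔-assoc a (suc u) k) ⟩
  (a ⊔ suc u) ⊔ k   ≡⟨ cong (_⊔ k) a⊔su≡sm ⟩
  suc m ⊔ k         ≡⟨ m≥n⇒m⊔n≡m (subst (k ≤_) (+-comm m 1) k≤) ⟩
  suc m             ≡⟨ +-comm 1 m ⟩
  m + 1             ∎
  where open ≡-Reasoning

-- The fold in `tilde` is local to its where-block.  Checking `solveTildeFold` forces the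
-- metavariable `tildeFold` to be that local function, which makes it available to induction.
mutual
  tildeFold : List ℕ → List ℕ → List ℕ → List ℕ
  tildeFold = _

  tilde≡tildeFold : ∀ x → tilde x ≡ tildeFold x (Ascbot x) x
  tilde≡tildeFold x = refl
    where
    solveTildeFold : ∀ y → tilde y ≡ tilde y
    solveTildeFold y with Ascbot y
    ... | []     = refl
    ... | i ∷ is with step y i
    ...   | acc = refl {x = tildeFold y is acc}

tildeFold≡foldl : ∀ x is acc → tildeFold x is acc ≡ foldl step acc is
tildeFold≡foldl x []       acc = refl
tildeFold≡foldl x (i ∷ is) acc = tildeFold≡foldl x is (step acc i)

tilde≡foldl : ∀ x → tilde x ≡ foldl step x (Ascbot x)
tilde≡foldl x = trans (tilde≡tildeFold x) (tildeFold≡foldl x (Ascbot x) x)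

length-bumpBefore : ∀ v j xs → length (bumpBefore v j xs) ≡ length xs
length-bumpBefore v zero    xs       = refl
length-bumpBefore v (suc j) []       = refl
length-bumpBefore v (suc j) (x ∷ xs) = cong suc (length-bumpBefore v j xs)

length-step : ∀ acc i → length (step acc i) ≡ length acc
length-step acc i = length-bumpBefore (at acc i) (i ∸ 1) acc

length-foldl-step : ∀ is acc → length (foldl step acc is) ≡ length acc
length-foldl-step []       acc = refl
length-foldl-step (i ∷ is) acc = trans (length-foldl-step is (step acc i)) (length-step acc i)

bumpBefore-++ : ∀ v j xs ys → j ≤ length xs → bumpBefore v j (xs ++ ys) ≡ bumpBefore v j xs ++ ys
bumpBefore-++ v zero    xs       ys _         = refl
bumpBefore-++ v (suc j) (x ∷ xs) ys (s≤s j≤) = cong (_ ∷_) (bumpBefore-++ v j xs ys j≤)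

at-++ : ∀ xs ys i → i ≤ length xs → at (xs ++ ys) i ≡ at xs i
at-++ []       []      zero          _         = refl
at-++ []       (_ ∷ _) zero          _         = refl
at-++ (_ ∷ _)  ys      zero          _         = refl
at-++ (_ ∷ _)  ys      (suc zero)    _         = refl
at-++ (_ ∷ xs) ys      (suc (suc i)) (s≤s i≤) = at-++ xs ys (suc i) i≤

at-∷ʳ : ∀ xs v ys → at (xs ++ v ∷ ys) (suc (length xs)) ≡ v
at-∷ʳ []       v ys = refl
at-∷ʳ (_ ∷ xs) v ys = at-∷ʳ xs v ys

step-++ : ∀ xs ys i → i ≤ length xs → step (xs ++ ys) i ≡ step xs i ++ ys
step-++ xs ys zero    _  = refl
step-++ xs ys (suc i) i≤ =
  trans (cong (λ v → bumpBefore v i (xs ++ ys)) (at-++ xs ys (suc i) i≤))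
        (bumpBefore-++ (at xs (suc i)) i xs ys (≤-trans (n≤1+n i) i≤))

step-∷ʳ : ∀ xs v ys → step (xs ++ v ∷ ys) (suc (length xs)) ≡ bumpBefore v (length xs) xs ++ v ∷ ys
step-∷ʳ xs v ys =
  trans (cong (λ u → bumpBefore u (length xs) (xs ++ v ∷ ys)) (at-∷ʳ xs v ys))
        (bumpBefore-++ v (length xs) xs (v ∷ ys) ≤-refl)

foldl-step-++ : ∀ {is} acc ys → All (_≤ length acc) is →
  foldl step (acc ++ ys) is ≡ foldl step acc is ++ ys
foldl-step-++ acc ys []                    = refl
foldl-step-++ acc ys (_∷_ {i} {is} i≤ is≤) =
  trans (cong (λ acc′ → foldl step acc′ is) (step-++ acc ys i i≤))
        (foldl-step-++ (step acc i) ys (subst (λ n → All (_≤ n) is) (sym (length-step acc i)) is≤))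

ascbotAt : ℕ → ℕ → ℕ → List ℕ
ascbotAt v k i = if v <ᵇ k then [ i ] else []

ascbotFrom-++-∷ʳ : ∀ i as q v k →
  as ++ ascbotFrom (suc i) (q ∷ʳ v ∷ʳ k) ≡
  (as ++ ascbotFrom (suc i) (q ∷ʳ v)) ++ ascbotAt v k (i + suc (length q))

ascbotFrom-∷ʳ : ∀ i q v k →
  ascbotFrom i (q ∷ʳ v ∷ʳ k) ≡ ascbotFrom i (q ∷ʳ v) ++ ascbotAt v k (i + length q)
ascbotFrom-∷ʳ i []          v k = trans (++-identityʳ _) (cong (ascbotAt v k) (sym (+-identityʳ i)))
ascbotFrom-∷ʳ i (a ∷ [])    v k = ascbotFrom-++-∷ʳ i (ascbotAt a v i) [] v k
ascbotFrom-∷ʳ i (a ∷ b ∷ q) v k = ascbotFrom-++-∷ʳ i (ascbotAt a b i) (b ∷ q) v k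

ascbotFrom-++-∷ʳ i as q v k = begin
  as ++ ascbotFrom (suc i) (q ∷ʳ v ∷ʳ k)
    ≡⟨ cong (as ++_) (ascbotFrom-∷ʳ (suc i) q v k) ⟩
  as ++ (ascbotFrom (suc i) (q ∷ʳ v) ++ ascbotAt v k (suc i + length q))
    ≡⟨ sym (++-assoc as _ _) ⟩
  (as ++ ascbotFrom (suc i) (q ∷ʳ v)) ++ ascbotAt v k (suc i + length q)
    ≡⟨ cong (λ n → (as ++ ascbotFrom (suc i) (q ∷ʳ v)) ++ ascbotAt v k n) (sym (+-suc i (length q))) ⟩
  (as ++ ascbotFrom (suc i) (q ∷ʳ v)) ++ ascbotAt v k (i + suc (length q)) ∎
  where open ≡-Reasoning

Ascbot-∷-∷ʳ : ∀ a q v → Ascbot (a ∷ q ∷ʳ v) ≡ 1 ∷ ascbotFrom 2 (q ∷ʳ v)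
Ascbot-∷-∷ʳ a []      v = refl
Ascbot-∷-∷ʳ a (_ ∷ _) v = refl

Ascbot-∷ʳ : ∀ a q v k → Ascbot (a ∷ q ∷ʳ v ∷ʳ k) ≡ Ascbot (a ∷ q ∷ʳ v) ++ ascbotAt v k (2 + length q)
Ascbot-∷ʳ a q v k = begin
  Ascbot (a ∷ q ∷ʳ v ∷ʳ k)                                ≡⟨ Ascbot-∷-∷ʳ a (q ∷ʳ v) k ⟩
  1 ∷ ascbotFrom 2 (q ∷ʳ v ∷ʳ k)                          ≡⟨ cong (1 ∷_) (ascbotFrom-∷ʳ 2 q v k) ⟩
  1 ∷ ascbotFrom 2 (q ∷ʳ v) ++ ascbotAt v k (2 + length q) ≡⟨ cong (_++ _) (sym (Ascbot-∷-∷ʳ a q v)) ⟩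
  Ascbot (a ∷ q ∷ʳ v) ++ ascbotAt v k (2 + length q)       ∎
  where open ≡-Reasoning

All-ascbotAt : ∀ {n} v k i → i ≤ n → All (_≤ n) (ascbotAt v k i)
All-ascbotAt v k i i≤n with v <ᵇ k
... | true  = i≤n ∷ []
... | false = []

ascbotFrom-suc-bound : ∀ i q v → All (_≤ i + suc (length q)) (ascbotFrom (suc (suc i)) (q ∷ʳ v))

ascbotFrom-bound : ∀ i q v → All (_≤ i + length q) (ascbotFrom (suc i) (q ∷ʳ v))
ascbotFrom-bound i []          v = []
ascbotFrom-bound i (a ∷ [])    v =
  ++⁺ (All-ascbotAt a v (suc i) (m<m+n i z<s)) (ascbotFrom-suc-bound i [] v)
ascbotFrom-bound i (a ∷ b ∷ q) v =
  ++⁺ (All-ascbotAt a b (suc i) (m<m+n i z<s)) (ascbotFrom-suc-bound i (b ∷ q) v)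

ascbotFrom-suc-bound i q v =
  subst (λ n → All (_≤ n) (ascbotFrom (suc (suc i)) (q ∷ʳ v))) (sym (+-suc i (length q)))
        (ascbotFrom-bound (suc i) q v)

Ascbot-bound : ∀ a q v → All (_≤ length (a ∷ q)) (Ascbot (a ∷ q ∷ʳ v))
Ascbot-bound a q v =
  subst (All (_≤ suc (length q))) (sym (Ascbot-∷-∷ʳ a q v)) (s≤s z≤n ∷ ascbotFrom-bound 1 q v)

-- x̃ with its last letter (which the steps of η never change) removed.
tildeInit : List ℕ → ℕ → List ℕ
tildeInit p v = foldl step p (Ascbot (p ∷ʳ v))

length-tildeInit : ∀ p v → length (tildeInit p v) ≡ length p
length-tildeInit p v = length-foldl-step (Ascbot (p ∷ʳ v)) p

tilde-∷ʳ : ∀ p v → tilde (p ∷ʳ v) ≡ tildeInit p v ∷ʳ v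
tilde-∷ʳ []      v = refl
tilde-∷ʳ (a ∷ q) v =
  trans (tilde≡foldl (a ∷ q ∷ʳ v)) (foldl-step-++ (a ∷ q) [ v ] (Ascbot-bound a q v))

tilde-∷ʳ-∷ʳ : ∀ p v k →
  tilde (p ∷ʳ v ∷ʳ k) ≡ foldl step (tildeInit p v ++ v ∷ k ∷ []) (ascbotAt v k (suc (length p)))
tilde-∷ʳ-∷ʳ [] v k with v <ᵇ k
... | true  = refl
... | false = refl
tilde-∷ʳ-∷ʳ (a ∷ q) v k = begin
  tilde (x ∷ʳ k)                                      ≡⟨ tilde≡foldl (x ∷ʳ k) ⟩
  foldl step (x ∷ʳ k) (Ascbot (x ∷ʳ k))               ≡⟨ cong (foldl step (x ∷ʳ k)) (Ascbot-∷ʳ a q v k) ⟩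
  foldl step (x ∷ʳ k) (Ascbot x ++ new)               ≡⟨ foldl-++ step (x ∷ʳ k) (Ascbot x) new ⟩
  foldl step (foldl step (x ∷ʳ k) (Ascbot x)) new     ≡⟨ cong (λ acc → foldl step acc new) initial ⟩
  foldl step (tildeInit (a ∷ q) v ++ v ∷ k ∷ []) new ∎
  where
  open ≡-Reasoning
  x   = a ∷ q ∷ʳ v
  new = ascbotAt v k (2 + length q)
  initial : foldl step (x ∷ʳ k) (Ascbot x) ≡ tildeInit (a ∷ q) v ++ v ∷ k ∷ []
  initial = trans (cong (λ w → foldl step w (Ascbot x)) (++-assoc (a ∷ q) [ v ] [ k ]))
                  (foldl-step-++ (a ∷ q) (v ∷ k ∷ []) (Ascbot-bound a q v))

bump-letter : ∀ v a → (if v ≤ᵇ a then suc a else a) ≡ (if a <ᵇ v then a else suc a)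
bump-letter v a with <-≤-connex a v
... | inj₁ a<v rewrite ≤ᵇ-false a<v | <ᵇ-true a<v  = refl
... | inj₂ v≤a rewrite ≤ᵇ-true v≤a  | <ᵇ-false v≤a = refl

bumpBefore-length≡addInit : ∀ v xs → bumpBefore v (length xs) xs ≡ addInit v xs
bumpBefore-length≡addInit v []       = refl
bumpBefore-length≡addInit v (a ∷ xs) = cong₂ _∷_ (bump-letter v a) (bumpBefore-length≡addInit v xs)

tilde-∷ʳ-∷ʳ-≥ : ∀ p {v k} → k ≤ v → tilde (p ∷ʳ v ∷ʳ k) ≡ tilde (p ∷ʳ v) ∷ʳ k
tilde-∷ʳ-∷ʳ-≥ p {v} {k} k≤v = begin
  tilde (p ∷ʳ v ∷ʳ k)                                       ≡⟨ tilde-∷ʳ-∷ʳ p v k ⟩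
  foldl step (P ++ v ∷ k ∷ []) (ascbotAt v k (suc (length p)))
    ≡⟨ cong (λ b → foldl step (P ++ v ∷ k ∷ []) (if b then [ suc (length p) ] else [])) (<ᵇ-false k≤v) ⟩
  P ++ v ∷ k ∷ []                                           ≡⟨ sym (++-assoc P [ v ] [ k ]) ⟩
  P ∷ʳ v ∷ʳ k                                               ≡⟨ cong (_∷ʳ k) (sym (tilde-∷ʳ p v)) ⟩
  tilde (p ∷ʳ v) ∷ʳ k                                       ∎
  where
  open ≡-Reasoning
  P = tildeInit p v

tilde-∷ʳ-∷ʳ-< : ∀ p {v k} → v < k → tilde (p ∷ʳ v ∷ʳ k) ≡ addInit v (tildeInit p v) ++ v ∷ k ∷ []
tilde-∷ʳ-∷ʳ-< p {v} {k} v<k = begin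
  tilde (p ∷ʳ v ∷ʳ k)                                       ≡⟨ tilde-∷ʳ-∷ʳ p v k ⟩
  foldl step (P ++ v ∷ k ∷ []) (ascbotAt v k (suc (length p)))
    ≡⟨ cong (λ b → foldl step (P ++ v ∷ k ∷ []) (if b then [ suc (length p) ] else [])) (<ᵇ-true v<k) ⟩
  step (P ++ v ∷ k ∷ []) (suc (length p))
    ≡⟨ cong (λ n → step (P ++ v ∷ k ∷ []) (suc n)) (sym (length-tildeInit p v)) ⟩
  step (P ++ v ∷ k ∷ []) (suc (length P))                   ≡⟨ step-∷ʳ P v [ k ] ⟩
  bumpBefore v (length P) P ++ v ∷ k ∷ []
    ≡⟨ cong (_++ v ∷ k ∷ []) (bumpBefore-length≡addInit v P) ⟩
  addInit v P ++ v ∷ k ∷ []                                 ∎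
  where
  open ≡-Reasoning
  P = tildeInit p v

max-addInit : ∀ v xs → max (addInit v xs) ⊔ suc v ≡ suc (max xs ⊔ v)
max-addInit v []       = refl
max-addInit v (a ∷ xs) = begin
  (a′ ⊔ max (addInit v xs)) ⊔ suc v   ≡⟨ ⊔-assoc a′ _ (suc v) ⟩
  a′ ⊔ (max (addInit v xs) ⊔ suc v)   ≡⟨ cong (a′ ⊔_) (max-addInit v xs) ⟩
  a′ ⊔ suc (max xs ⊔ v)               ≡⟨ addInit-letter-⊔ (m≤n⊔m (max xs) v) ⟩
  suc (a ⊔ (max xs ⊔ v))              ≡⟨ cong suc (sym (⊔-assoc a (max xs) v)) ⟩
  suc ((a ⊔ max xs) ⊔ v)              ∎
  where
  open ≡-Reasoning
  a′ = if a <ᵇ v then a else suc a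
  addInit-letter-⊔ : ∀ {m} → v ≤ m → a′ ⊔ suc m ≡ suc (a ⊔ m)
  addInit-letter-⊔ {m} v≤m with <-≤-connex a v
  ... | inj₁ a<v rewrite <ᵇ-true a<v =
    trans (m≤n⇒m⊔n≡n (m≤n⇒m≤1+n a≤m)) (cong suc (sym (m≤n⇒m⊔n≡n a≤m)))
    where a≤m = ≤-trans (<⇒≤ a<v) v≤m
  ... | inj₂ v≤a rewrite <ᵇ-false v≤a = refl

Add-∷ʳ-≥ : ∀ xs {v ℓ} → ℓ ≤ v → Add (xs ∷ʳ v) ℓ ≡ xs ∷ʳ v ∷ʳ ℓ
Add-∷ʳ-≥ xs {v} ℓ≤v rewrite reverse-++ xs [ v ] | ≤ᵇ-true ℓ≤v = refl

Add-∷ʳ-< : ∀ xs {v ℓ} → v < ℓ → Add (xs ∷ʳ v) ℓ ≡ addInit v xs ++ v ∷ ℓ ∷ []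
Add-∷ʳ-< xs {v} v<ℓ rewrite reverse-++ xs [ v ] | ≤ᵇ-false v<ℓ | reverse-involutive xs = refl

ascents-++-∷ʳ : ∀ c q u k →
  c + ascents (q ∷ʳ u ∷ʳ k) ≡ (c + ascents (q ∷ʳ u)) + (if u <ᵇ k then 1 else 0)

ascents-∷ʳ : ∀ q u k → ascents (q ∷ʳ u ∷ʳ k) ≡ ascents (q ∷ʳ u) + (if u <ᵇ k then 1 else 0)
ascents-∷ʳ []          u k = +-identityʳ _
ascents-∷ʳ (a ∷ [])    u k = ascents-++-∷ʳ (if a <ᵇ u then 1 else 0) [] u k
ascents-∷ʳ (a ∷ b ∷ q) u k = ascents-++-∷ʳ (if a <ᵇ b then 1 else 0) (b ∷ q) u k

ascents-++-∷ʳ c q u k = trans (cong (c +_) (ascents-∷ʳ q u k)) (sym (+-assoc c _ _))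

asctop-∷ʳ : ∀ q u k → asctop (q ∷ʳ u ∷ʳ k) ≡ asctop (q ∷ʳ u) + (if u <ᵇ k then 1 else 0)
asctop-∷ʳ []      u k = cong suc (ascents-∷ʳ [] u k)
asctop-∷ʳ (a ∷ q) u k = cong suc (ascents-∷ʳ (a ∷ q) u k)

asctop-∷ʳ-< : ∀ q {u k} → u < k → asctop (q ∷ʳ u ∷ʳ k) ≡ asctop (q ∷ʳ u) + 1
asctop-∷ʳ-< q {u} {k} u<k =
  trans (asctop-∷ʳ q u k) (cong (λ b → asctop (q ∷ʳ u) + (if b then 1 else 0)) (<ᵇ-true u<k))

asctop-∷ʳ-≥ : ∀ q {u k} → k ≤ u → asctop (q ∷ʳ u ∷ʳ k) ≡ asctop (q ∷ʳ u)
asctop-∷ʳ-≥ q {u} {k} k≤u =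
  trans (asctop-∷ʳ q u k)
        (trans (cong (λ b → asctop (q ∷ʳ u) + (if b then 1 else 0)) (<ᵇ-false k≤u)) (+-identityʳ _))

last≤asctop-∷ʳ : ∀ q {u k} → u ≤ asctop (q ∷ʳ u) → k ≤ asctop (q ∷ʳ u) + 1 → k ≤ asctop (q ∷ʳ u ∷ʳ k)
last≤asctop-∷ʳ q {u} {k} u≤ k≤ with <-≤-connex u k
... | inj₁ u<k = subst (k ≤_) (sym (asctop-∷ʳ-< q u<k)) k≤
... | inj₂ k≤u = subst (k ≤_) (sym (asctop-∷ʳ-≥ q k≤u)) (≤-trans k≤u u≤)

ascentSeq-last≤asctop : ∀ {xs k} → IsAscentSeq xs → k ≤ asctop xs + 1 → k ≤ asctop (xs ∷ʳ k)
ascentSeq-last≤asctop one              k≤ = last≤asctop-∷ʳ [] ≤-refl k≤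
ascentSeq-last≤asctop (snoc _ d _ u≤) k≤ = last≤asctop-∷ʳ _ (ascentSeq-last≤asctop d u≤) k≤

module _ (p : List ℕ) {u k : ℕ} (u≤ : u ≤ asctop (p ∷ʳ u))
         (asctop≡ : asctop (p ∷ʳ u) ≡ max (tilde (p ∷ʳ u))) (k≤ : k ≤ asctop (p ∷ʳ u) + 1) where

  private
    M = max (tilde (p ∷ʳ u))
    P = tildeInit p u

  asctop≡max-tilde-∷ʳ : asctop (p ∷ʳ u ∷ʳ k) ≡ max (tilde (p ∷ʳ u ∷ʳ k))
  asctop≡max-tilde-∷ʳ with <-≤-connex u k
  ... | inj₂ k≤u = begin
    asctop (p ∷ʳ u ∷ʳ k)          ≡⟨ asctop-∷ʳ-≥ p k≤u ⟩
    asctop (p ∷ʳ u)               ≡⟨ sym (m≥n⇒m⊔n≡m (≤-trans k≤u u≤)) ⟩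
    asctop (p ∷ʳ u) ⊔ k           ≡⟨ cong (_⊔ k) asctop≡ ⟩
    M ⊔ k                         ≡⟨ sym (max-∷ʳ (tilde (p ∷ʳ u)) k) ⟩
    max (tilde (p ∷ʳ u) ∷ʳ k)     ≡⟨ cong max (sym (tilde-∷ʳ-∷ʳ-≥ p k≤u)) ⟩
    max (tilde (p ∷ʳ u ∷ʳ k))     ∎
    where open ≡-Reasoning
  ... | inj₁ u<k = begin
    asctop (p ∷ʳ u ∷ʳ k)          ≡⟨ asctop-∷ʳ-< p u<k ⟩
    asctop (p ∷ʳ u) + 1           ≡⟨ sym (⊔-ascent max-addInit-∷ʳ u<k k≤) ⟩
    max A ⊔ (u ⊔ k)               ≡⟨ cong (λ n → max A ⊔ (u ⊔ n)) (sym (⊔-identityʳ k)) ⟩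
    max A ⊔ max (u ∷ k ∷ [])      ≡⟨ sym (max-++ A (u ∷ k ∷ [])) ⟩
    max (A ++ u ∷ k ∷ [])         ≡⟨ cong max (sym (tilde-∷ʳ-∷ʳ-< p u<k)) ⟩
    max (tilde (p ∷ʳ u ∷ʳ k))     ∎
    where
    open ≡-Reasoning
    A = addInit u P
    max-addInit-∷ʳ : max A ⊔ suc u ≡ suc (asctop (p ∷ʳ u))
    max-addInit-∷ʳ = trans (max-addInit u P)
      (cong suc (sym (trans asctop≡ (trans (cong max (tilde-∷ʳ p u)) (max-∷ʳ P u)))))

  η-∷ʳ-step : η (p ∷ʳ u ∷ʳ k) ≡ Add (η (p ∷ʳ u)) k
  η-∷ʳ-step with <-≤-connex u k
  ... | inj₂ k≤u = begin
    max (tilde x) ∷ tilde x         ≡⟨ cong₂ _∷_ max-unchanged (tilde-∷ʳ-∷ʳ-≥ p k≤u) ⟩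
    M ∷ tilde (p ∷ʳ u) ∷ʳ k         ≡⟨ cong (λ t → M ∷ t ∷ʳ k) (tilde-∷ʳ p u) ⟩
    (M ∷ P) ∷ʳ u ∷ʳ k               ≡⟨ sym (Add-∷ʳ-≥ (M ∷ P) k≤u) ⟩
    Add ((M ∷ P) ∷ʳ u) k            ≡⟨ cong (λ t → Add (M ∷ t) k) (sym (tilde-∷ʳ p u)) ⟩
    Add (η (p ∷ʳ u)) k              ∎
    where
    open ≡-Reasoning
    x = p ∷ʳ u ∷ʳ k
    max-unchanged : max (tilde x) ≡ M
    max-unchanged = trans (sym asctop≡max-tilde-∷ʳ) (trans (asctop-∷ʳ-≥ p k≤u) asctop≡)
  ... | inj₁ u<k = begin
    max (tilde x) ∷ tilde x         ≡⟨ cong₂ _∷_ max-bumped (tilde-∷ʳ-∷ʳ-< p u<k) ⟩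
    suc M ∷ addInit u P ++ u ∷ k ∷ []
      ≡⟨ cong (λ b → (if b then M else suc M) ∷ addInit u P ++ u ∷ k ∷ []) (sym (<ᵇ-false u≤M)) ⟩
    addInit u (M ∷ P) ++ u ∷ k ∷ [] ≡⟨ sym (Add-∷ʳ-< (M ∷ P) u<k) ⟩
    Add ((M ∷ P) ∷ʳ u) k            ≡⟨ cong (λ t → Add (M ∷ t) k) (sym (tilde-∷ʳ p u)) ⟩
    Add (η (p ∷ʳ u)) k              ∎
    where
    open ≡-Reasoning
    x = p ∷ʳ u ∷ʳ k
    u≤M : u ≤ M
    u≤M = subst (u ≤_) asctop≡ u≤
    max-bumped : max (tilde x) ≡ suc M
    max-bumped = trans (sym asctop≡max-tilde-∷ʳ)
      (trans (asctop-∷ʳ-< p u<k) (trans (cong (_+ 1) asctop≡) (+-comm M 1)))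

asctop≡max-tilde : ∀ {x} → IsAscentSeq x → asctop x ≡ max (tilde x)
asctop≡max-tilde one                              = refl
asctop≡max-tilde (snoc _ one _ k≤)                = asctop≡max-tilde-∷ʳ [] ≤-refl refl k≤
asctop≡max-tilde (snoc _ d@(snoc _ d′ _ u≤) _ k≤) =
  asctop≡max-tilde-∷ʳ _ (ascentSeq-last≤asctop d′ u≤) (asctop≡max-tilde d) k≤

η-∷ʳ : ∀ {x k} → IsAscentSeq x → k ≤ asctop x + 1 → η (x ∷ʳ k) ≡ Add (η x) k
η-∷ʳ one                 k≤ = η-∷ʳ-step [] ≤-refl refl k≤
η-∷ʳ d@(snoc _ d′ _ u≤) k≤ = η-∷ʳ-step _ (ascentSeq-last≤asctop d′ u≤) (asctop≡max-tilde d) k≤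

IsAscentSeq-∷ʳ⁻ : ∀ {a xs k} → IsAscentSeq (a ∷ xs ∷ʳ k) → IsAscentSeq (a ∷ xs) × k ≤ asctop (a ∷ xs) + 1
IsAscentSeq-∷ʳ⁻ {a} {xs} {k} d = invert d refl
  where
  invert : ∀ {ys} → IsAscentSeq ys → ys ≡ a ∷ xs ∷ʳ k → IsAscentSeq (a ∷ xs) × k ≤ asctop (a ∷ xs) + 1
  invert one eq with ∷ʳ-injective [] (a ∷ xs) eq
  ... | () , _
  invert (snoc {ys} _ d _ k≤) eq with ∷ʳ-injective ys (a ∷ xs) eq
  ... | refl , refl = d , k≤

mainTheorem19 : (x' : List ℕ) (xn : ℕ) → 2 ≤ length (x' ++ xn ∷ []) →
    IsAscentSeq (x' ++ xn ∷ []) →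
    (asctop (x' ++ xn ∷ []) ≡ max (η (x' ++ xn ∷ [])))
      × (η (x' ++ xn ∷ []) ≡ Add (η x') xn)
mainTheorem19 []      xn (s≤s ()) _
mainTheorem19 (_ ∷ _) xn _        d with IsAscentSeq-∷ʳ⁻ d
... | d′ , xn≤ = trans (asctop≡max-tilde d) (sym (⊔-idem _)) , η-∷ʳ d′ xn≤
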